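{- Let ${\mathcal I} = (G,k,W_1,W_2,U)$ be an instance of Disjoint Finite ($\Pi_1, \Pi_2, \dotsc , \Pi_d$)-VDC with Undeletable Vertices where $W_1$ and $W_2$ are in distinct components of $G$. Let $Z$ be its solution such that $W_1$ exactly occurs in a connected component of $G \setminus Z$. Also let $R(W_1)$ be the set of vertices reachable from $W_1$ in $G$. Let $Z' = Z \cap R(W_1)$. Then $(G[R(W_1)],|Z'|,W_1, U \cap R(W_1))$ is a non-separating YES-instance of Disjoint Finite ($\Pi_1, \Pi_2, \dotsc , \Pi_d$)-VDC with Undeletable Vertices and conversely for any non-separating solution $Z''$ for $(G[R(W_1)],|Z'|,W_1, U \cap R(W_1))$, the set $\hat{Z} = (Z \setminus Z') \cup Z''$ is a solution for the original instance such that $W_1$ exactly occurs in a connected component of $G \setminus Z''$.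
   Context: $\Pi_1,\ldots,\Pi_d$ are graph classes, each characterized by a finite forbidden family ${\mathcal F}_i$ of induced subgraphs. A ($\Pi_1, \Pi_2, \dotsc , \Pi_d$)-modulator of $G$ is a set $Z$ such that every connected component of $G\setminus Z$ is in one of the $\Pi_i$. Disjoint Finite ($\Pi_1, \Pi_2, \dotsc , \Pi_d$)-VDC with Undeletable Vertices: given $G$, $k$, the families ${\mathcal F}_i$, a ($\Pi_1, \Pi_2, \dotsc , \Pi_d$)-modulator $W\subseteq V(G)$ of size $k+1$ and a set $U\subseteq V(G)$, decide whether there is $Z\subseteq V(G)\setminus(W\cup U)$, $|Z|\le k$, that is a ($\Pi_1, \Pi_2, \dotsc , \Pi_d$)-modulator of $G$. An instance $(G,k,W_1,W_2,U)$ denotes such an instance with $W=W_1\uplus W_2$, where one seeks a solution in which $W_1$ is exactly the intersection of $W$ with one connected component of $G\setminus Z$. A solution is non-separating if $W$ (here $W_1$) lies in a single connected component of the graph minus the solution. -}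

module Defs where

open import Data.Nat using (ℕ; suc; _≤_)
open import Data.Bool using (Bool; true; false)
open import Data.Fin using (Fin)
open import Data.Fin.Subset using (Subset; _∈_; _∉_; _⊆_; _─_; ∣_∣)
open import Data.List using (List)
open import Data.List.Relation.Unary.All using (All)
open import Data.Product using (Σ; ∃; _×_)
open import Relation.Binary.PropositionalEquality using (_≡_)
open import Relation.Nullary using (¬_)
open import Function.Definitions using (Injective)

record Graph (n : ℕ) : Set where
  field
    adj    : Fin n → Fin n → Bool
    sym    : ∀ u v → adj u v ≡ adj v u
    irrefl : ∀ v → adj v v ≡ false
open Graph public

FGraph : Set
FGraph = Σ ℕ Graph

data Reach {n : ℕ} (G : Graph n) (X : Subset n) (u : Fin n) : Fin n → Set where
  here : u ∈ X → Reach G X u u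
  step : ∀ {v w} → Reach G X u v → adj G v w ≡ true → w ∈ X → Reach G X u w

InducedIn : {n : ℕ} → FGraph → Graph n → (Fin n → Set) → Set
InducedIn {n} (m Data.Product., H) G C =
  Σ (Fin m → Fin n) λ f →
    Injective _≡_ _≡_ f × (∀ i → C (f i)) × (∀ i j → adj H i j ≡ adj G (f i) (f j))

-- The induced subgraph G[C] belongs to the class characterised by the finite
-- forbidden family F (no member of F is an induced subgraph of G[C]).
InClass : {n : ℕ} → Graph n → List FGraph → (Fin n → Set) → Set
InClass G F C = All (λ H → ¬ InducedIn H G C) F

-- Z is a (Π_1,…,Π_d)-modulator of G[S]: every connected component of
-- G[S] ∖ Z (the component of each vertex v ∈ S ∖ Z) lies in some Π_i.
Modulator : {n d : ℕ} → Graph n → (Fin d → List FGraph) → Subset n → Subset n → Set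
Modulator {d = d} G Fs S Z =
  ∀ v → v ∈ S → v ∉ Z → Σ (Fin d) λ i → InClass G (Fs i) (Reach G (S ─ Z) v)

-- Z is a solution of the instance (G[S], k, W1, W2, U) with W = W1 ∪ W2:
-- Z ⊆ S ∖ (W ∪ U), |Z| ≤ k, Z modulator of G[S], and W1 is exactly the
-- intersection of W with one connected component of G[S] ∖ Z.
Solution : {n d : ℕ} → Graph n → (Fin d → List FGraph) → Subset n → ℕ →
           Subset n → Subset n → Subset n → Subset n → Set
Solution G Fs S k W W1 U Z =
  Z ⊆ S × (∀ v → v ∈ Z → v ∉ W) × (∀ v → v ∈ Z → v ∉ U) × ∣ Z ∣ ≤ k ×
  Modulator G Fs S Z ×
  Σ _ λ v → v ∈ S × v ∉ Z × (∀ w → w ∈ W → (w ∈ W1 → Reach G (S ─ Z) v w)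
                                              × (Reach G (S ─ Z) v w → w ∈ W1))

NonSepSolution : {n d : ℕ} → Graph n → (Fin d → List FGraph) → Subset n → ℕ →
                 Subset n → Subset n → Subset n → Set
NonSepSolution G Fs S k W U Z =
  Z ⊆ S × (∀ v → v ∈ Z → v ∉ W) × (∀ v → v ∈ Z → v ∉ U) × ∣ Z ∣ ≤ k ×
  Modulator G Fs S Z ×
  (∀ w w' → w ∈ W → w' ∈ W → Reach G (S ─ Z) w w')

-- R(W₁) is a union of connected components of G, so no edge leaves it.  Hence
-- a connected component of G ∖ X lies entirely inside R(W₁) or entirely
-- outside it, and inside it only X ∩ R(W₁) matters.  Restricting Z to R(W₁)
-- therefore keeps every component of G[R(W₁)] ∖ Z′ inside a component of
-- G ∖ Z, and replacing Z′ by any Z″ of at most the same size changes the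
-- components inside R(W₁) only, which the modulator property of Z″ controls;
-- W₂ is unaffected because it lies outside R(W₁).
module Submission where

open import Defs renaming (sym to adj-sym)
open import Data.Nat using (ℕ; suc; _+_; _≤_; z≤n; s≤s)
open import Data.Nat.Properties using (+-suc; +-monoʳ-≤; ≤-trans; ≤-refl; ≤-reflexive; n≤1+n)
open import Data.Bool using (true)
open import Data.Fin using (Fin)
open import Data.Fin.Subset
  using (Subset; inside; outside; _∈_; _∉_; _⊆_; _∩_; _∪_; _─_; ⊤; ∣_∣)
open import Data.Fin.Subset.Properties
  using (∈⊤; _∈?_; x∈p∩q⁺; x∈p∩q⁻; x∈p∪q⁻; p⊆p∪q; q⊆p∪q; p─q⊆p; x∈p∧x∉q⇒x∈p─q)
open import Data.Fin.Properties using (any?)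
open import Data.Vec using ([]; _∷_; here; there)
open import Data.List using (List)
open import Data.List.Relation.Unary.All as All using ()
open import Data.Product using (Σ; _×_; _,_; proj₁; proj₂)
open import Data.Sum using (inj₁; inj₂; _⊎_; [_,_]′)
open import Function using (_∘_)
open import Data.Empty using (⊥-elim)
open import Relation.Binary.PropositionalEquality using (_≡_; refl; cong; sym; trans)
open import Relation.Nullary using (¬_; yes; no)

private
  variable
    n d : ℕ

x∈p─q⇒x∉q : {p q : Subset n} {x : Fin n} → x ∈ p ─ q → x ∉ q
x∈p─q⇒x∉q {p = inside ∷ _} {outside ∷ _} here ()
x∈p─q⇒x∉q {p = _ ∷ _} {outside ∷ _} (there x∈) (there x∈q) = x∈p─q⇒x∉q x∈ x∈q
x∈p─q⇒x∉q {p = _ ∷ _} {inside ∷ _}  (there x∈) (there x∈q) = x∈p─q⇒x∉q x∈ x∈q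

∣p∪q∣≤∣p∣+∣q∣ : (p q : Subset n) → ∣ p ∪ q ∣ ≤ ∣ p ∣ + ∣ q ∣
∣p∪q∣≤∣p∣+∣q∣ []            []            = z≤n
∣p∪q∣≤∣p∣+∣q∣ (outside ∷ p) (outside ∷ q) = ∣p∪q∣≤∣p∣+∣q∣ p q
∣p∪q∣≤∣p∣+∣q∣ (outside ∷ p) (inside  ∷ q) =
  ≤-trans (s≤s (∣p∪q∣≤∣p∣+∣q∣ p q)) (≤-reflexive (sym (+-suc ∣ p ∣ ∣ q ∣)))
∣p∪q∣≤∣p∣+∣q∣ (inside  ∷ p) (outside ∷ q) = s≤s (∣p∪q∣≤∣p∣+∣q∣ p q)
∣p∪q∣≤∣p∣+∣q∣ (inside  ∷ p) (inside  ∷ q) =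
  s≤s (≤-trans (∣p∪q∣≤∣p∣+∣q∣ p q) (+-monoʳ-≤ ∣ p ∣ (n≤1+n ∣ q ∣)))

∣p─p∩q∣+∣p∩q∣≡∣p∣ : (p q : Subset n) → ∣ p ─ (p ∩ q) ∣ + ∣ p ∩ q ∣ ≡ ∣ p ∣
∣p─p∩q∣+∣p∩q∣≡∣p∣ []            []            = refl
∣p─p∩q∣+∣p∩q∣≡∣p∣ (outside ∷ p) (_       ∷ q) = ∣p─p∩q∣+∣p∩q∣≡∣p∣ p q
∣p─p∩q∣+∣p∩q∣≡∣p∣ (inside  ∷ p) (outside ∷ q) = cong suc (∣p─p∩q∣+∣p∩q∣≡∣p∣ p q)
∣p─p∩q∣+∣p∩q∣≡∣p∣ (inside  ∷ p) (inside  ∷ q) =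
  trans (+-suc ∣ p ─ (p ∩ q) ∣ ∣ p ∩ q ∣) (cong suc (∣p─p∩q∣+∣p∩q∣≡∣p∣ p q))

module _ (G : Graph n) where

  Closed : (Fin n → Set) → Set
  Closed P = ∀ {x y} → P x → adj G x y ≡ true → P y

  Closed-¬ : {P : Fin n → Set} → Closed P → Closed (λ x → ¬ P x)
  Closed-¬ closed ¬Px e Py = ¬Px (closed Py (trans (adj-sym G _ _) e))

  Reach-prepend : ∀ {X u v w} → adj G u v ≡ true → u ∈ X → Reach G X v w → Reach G X u w
  Reach-prepend e u∈X (here v∈X)       = step (here u∈X) e v∈X
  Reach-prepend e u∈X (step r e′ w∈X) = step (Reach-prepend e u∈X r) e′ w∈X

  Reach-sym : ∀ {X u v} → Reach G X u v → Reach G X v u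
  Reach-sym (here u∈X)      = here u∈X
  Reach-sym (step r e w∈X) = Reach-prepend (trans (adj-sym G _ _) e) w∈X (Reach-sym r)

  Reach-trans : ∀ {X u v w} → Reach G X u v → Reach G X v w → Reach G X u w
  Reach-trans r (here _)         = r
  Reach-trans r (step r′ e w∈X) = step (Reach-trans r r′) e w∈X

  Reach-mono : ∀ {X Y u v} → X ⊆ Y → Reach G X u v → Reach G Y u v
  Reach-mono X⊆Y (here u∈X)      = here (X⊆Y u∈X)
  Reach-mono X⊆Y (step r e w∈X) = step (Reach-mono X⊆Y r) e (X⊆Y w∈X)

  Reach-closed : ∀ {P X u v} → Closed P → P u → Reach G X u v → P v
  Reach-closed closed Pu (here _)       = Pu
  Reach-closed closed Pu (step r e _) = closed (Reach-closed closed Pu r) e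

  -- A walk from a vertex of a closed set P never leaves P, so only X ∩ P matters.
  Reach-within : ∀ {P X Y u v} → Closed P → (∀ {x} → P x → x ∈ X → x ∈ Y) →
                 P u → Reach G X u v → Reach G Y u v
  Reach-within closed X∩P⊆Y Pu (here u∈X) = here (X∩P⊆Y Pu u∈X)
  Reach-within closed X∩P⊆Y Pu (step r e w∈X) =
    step (Reach-within closed X∩P⊆Y Pu r) e
         (X∩P⊆Y (Reach-closed closed Pu (step r e w∈X)) w∈X)

InClass-anti : (G : Graph n) (F : List FGraph) {C C′ : Fin n → Set} →
               (∀ {x} → C′ x → C x) → InClass G F C → InClass G F C′
InClass-anti G F C′⊆C =
  All.map λ ¬H⊑C (f , f-inj , f∈C′ , f-adj) → ¬H⊑C (f , f-inj , (λ i → C′⊆C (f∈C′ i)) , f-adj)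

p─q∩p⊆⊤─q : (p q : Subset n) → p ─ (q ∩ p) ⊆ ⊤ ─ q
p─q∩p⊆⊤─q p q x∈ = x∈p∧x∉q⇒x∈p─q ∈⊤ λ x∈q → x∈p─q⇒x∉q x∈ (x∈p∩q⁺ (x∈q , p─q⊆p p _ x∈))

Modulator-restrict : {G : Graph n} {Fs : Fin d → List FGraph} {Z : Subset n} (R : Subset n) →
                     Modulator G Fs ⊤ Z → Modulator G Fs R (Z ∩ R)
Modulator-restrict {G = G} {Fs} {Z} R mod v v∈R v∉Z∩R
  with mod v ∈⊤ (λ v∈Z → v∉Z∩R (x∈p∩q⁺ (v∈Z , v∈R)))
... | i , inClass = i , InClass-anti G (Fs i) {C′ = Reach G _ v} (Reach-mono G (p─q∩p⊆⊤─q R Z)) inClass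

replaceOn : Subset n → Subset n → Subset n → Subset n
replaceOn R Z Z″ = (Z ─ (Z ∩ R)) ∪ Z″

module _ {R Z Z″ : Subset n} {x : Fin n} where

  replaceOn⁻ : x ∈ replaceOn R Z Z″ → x ∈ Z ⊎ x ∈ Z″
  replaceOn⁻ x∈ with x∈p∪q⁻ (Z ─ (Z ∩ R)) Z″ x∈
  ... | inj₁ x∈Z─ = inj₁ (p─q⊆p Z _ x∈Z─)
  ... | inj₂ x∈Z″ = inj₂ x∈Z″

  replaceOn-inside⁻ : x ∈ R → x ∈ replaceOn R Z Z″ → x ∈ Z″
  replaceOn-inside⁻ x∈R x∈ with x∈p∪q⁻ (Z ─ (Z ∩ R)) Z″ x∈
  ... | inj₁ x∈Z─ = ⊥-elim (x∈p─q⇒x∉q x∈Z─ (x∈p∩q⁺ (p─q⊆p Z _ x∈Z─ , x∈R)))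
  ... | inj₂ x∈Z″ = x∈Z″

  replaceOn-inside⁺ : x ∈ Z″ → x ∈ replaceOn R Z Z″
  replaceOn-inside⁺ = q⊆p∪q (Z ─ (Z ∩ R)) Z″

  replaceOn-outside⁻ : Z″ ⊆ R → x ∉ R → x ∈ replaceOn R Z Z″ → x ∈ Z
  replaceOn-outside⁻ Z″⊆R x∉R x∈ with replaceOn⁻ x∈
  ... | inj₁ x∈Z  = x∈Z
  ... | inj₂ x∈Z″ = ⊥-elim (x∉R (Z″⊆R x∈Z″))

  replaceOn-outside⁺ : x ∉ R → x ∈ Z → x ∈ replaceOn R Z Z″
  replaceOn-outside⁺ x∉R x∈Z =
    p⊆p∪q Z″ (x∈p∧x∉q⇒x∈p─q x∈Z λ x∈Z∩R → x∉R (proj₂ (x∈p∩q⁻ Z R x∈Z∩R)))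

∣replaceOn∣≤∣Z∣ : (R Z Z″ : Subset n) → ∣ Z″ ∣ ≤ ∣ Z ∩ R ∣ → ∣ replaceOn R Z Z″ ∣ ≤ ∣ Z ∣
∣replaceOn∣≤∣Z∣ R Z Z″ ∣Z″∣≤ = ≤-trans (∣p∪q∣≤∣p∣+∣q∣ (Z ─ (Z ∩ R)) Z″)
  (≤-trans (+-monoʳ-≤ ∣ Z ─ (Z ∩ R) ∣ ∣Z″∣≤) (≤-reflexive (∣p─p∩q∣+∣p∩q∣≡∣p∣ Z R)))

Modulator-replaceOn : {G : Graph n} {Fs : Fin d → List FGraph} {R Z Z″ : Subset n} →
                      Closed G (_∈ R) → Modulator G Fs R Z″ → Modulator G Fs ⊤ Z →
                      Modulator G Fs ⊤ (replaceOn R Z Z″)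
Modulator-replaceOn {G = G} {Fs} {R} {Z} {Z″} closed modR mod v _ v∉Ẑ with v ∈? R
... | yes v∈R with modR v v∈R (λ v∈Z″ → v∉Ẑ (replaceOn-inside⁺ v∈Z″))
...   | i , inClass = i , InClass-anti G (Fs i) {C′ = Reach G _ v} (Reach-within G closed inR v∈R) inClass
  where
  inR : ∀ {x} → x ∈ R → x ∈ ⊤ ─ replaceOn R Z Z″ → x ∈ R ─ Z″
  inR x∈R x∉Ẑ = x∈p∧x∉q⇒x∈p─q x∈R λ x∈Z″ → x∈p─q⇒x∉q x∉Ẑ (replaceOn-inside⁺ x∈Z″)
Modulator-replaceOn {G = G} {Fs} {R} {Z} {Z″} closed modR mod v _ v∉Ẑ
  | no v∉R with mod v ∈⊤ (λ v∈Z → v∉Ẑ (replaceOn-outside⁺ v∉R v∈Z))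
...   | i , inClass = i , InClass-anti G (Fs i) {C′ = Reach G _ v} (Reach-within G (Closed-¬ G closed) outR v∉R) inClass
  where
  outR : ∀ {x} → x ∉ R → x ∈ ⊤ ─ replaceOn R Z Z″ → x ∈ ⊤ ─ Z
  outR x∉R x∉Ẑ = x∈p∧x∉q⇒x∈p─q ∈⊤ λ x∈Z → x∈p─q⇒x∉q x∉Ẑ (replaceOn-outside⁺ x∉R x∈Z)

ReachableSet : Graph n → Subset n → Subset n → Set
ReachableSet {n} G W R =
  ∀ v → (v ∈ R → Σ (Fin n) λ w → w ∈ W × Reach G ⊤ w v)
      × ((Σ (Fin n) λ w → w ∈ W × Reach G ⊤ w v) → v ∈ R)

module _ {G : Graph n} {W R : Subset n} (isR : ReachableSet G W R) where

  ReachableSet-closed : Closed G (_∈ R)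
  ReachableSet-closed {x} {y} x∈R e with proj₁ (isR x) x∈R
  ... | w , w∈W , r = proj₂ (isR y) (w , w∈W , step r e ∈⊤)

  ReachableSet-⊇ : W ⊆ R
  ReachableSet-⊇ {w} w∈W = proj₂ (isR w) (w , w∈W , here ∈⊤)

  ReachableSet-apart : {W′ : Subset n} → (∀ w w′ → w ∈ W → w′ ∈ W′ → ¬ Reach G ⊤ w w′) →
                       ∀ {x} → x ∈ R → x ∉ W′
  ReachableSet-apart apart {x} x∈R x∈W′ with proj₁ (isR x) x∈R
  ... | w , w∈W , r = apart w x w∈W x∈W′ r

Solution-restrict : {G : Graph n} {Fs : Fin d → List FGraph} {k : ℕ} {W W₁ U Z R : Subset n} →
                    W₁ ⊆ W → Closed G (_∈ R) → W₁ ⊆ R → Solution G Fs ⊤ k W W₁ U Z →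
                    NonSepSolution G Fs R ∣ Z ∩ R ∣ W₁ (U ∩ R) (Z ∩ R)
Solution-restrict {G = G} {W₁ = W₁} {U} {Z} {R} W₁⊆W closed W₁⊆R
                  (_ , Z∉W , Z∉U , _ , mod , v , _ , _ , component) =
    (λ {x} → proj₂ ∘ x∈p∩q⁻ Z R)
  , (λ x x∈Z∩R x∈W₁ → Z∉W x (proj₁ (x∈p∩q⁻ Z R x∈Z∩R)) (W₁⊆W x∈W₁))
  , (λ x x∈Z∩R x∈U∩R → Z∉U x (proj₁ (x∈p∩q⁻ Z R x∈Z∩R)) (proj₁ (x∈p∩q⁻ U R x∈U∩R)))
  , ≤-refl
  , Modulator-restrict R mod
  , connected
  where
  reach : ∀ {w} → w ∈ W₁ → Reach G (⊤ ─ Z) v w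
  reach w∈W₁ = proj₁ (component _ (W₁⊆W w∈W₁)) w∈W₁

  inR : ∀ {x} → x ∈ R → x ∈ ⊤ ─ Z → x ∈ R ─ (Z ∩ R)
  inR x∈R x∉Z = x∈p∧x∉q⇒x∈p─q x∈R λ x∈Z∩R → x∈p─q⇒x∉q x∉Z (proj₁ (x∈p∩q⁻ Z R x∈Z∩R))

  -- All of W₁ lies in the component of v, which is contained in R.
  connected : ∀ w w′ → w ∈ W₁ → w′ ∈ W₁ → Reach G (R ─ (Z ∩ R)) w w′
  connected w w′ w∈W₁ w′∈W₁ =
    Reach-within G closed inR (W₁⊆R w∈W₁) (Reach-trans G (Reach-sym G (reach w∈W₁)) (reach w′∈W₁))

Solution-replaceOn : {G : Graph n} {Fs : Fin d → List FGraph} {k : ℕ} {W₁ W₂ U Z R Z″ : Subset n} →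
                     ReachableSet G W₁ R → (∀ w₁ w₂ → w₁ ∈ W₁ → w₂ ∈ W₂ → ¬ Reach G ⊤ w₁ w₂) →
                     Solution G Fs ⊤ k (W₁ ∪ W₂) W₁ U Z →
                     NonSepSolution G Fs R ∣ Z ∩ R ∣ W₁ (U ∩ R) Z″ →
                     Solution G Fs ⊤ k (W₁ ∪ W₂) W₁ U (replaceOn R Z Z″)
Solution-replaceOn {n} {G = G} {W₁ = W₁} {W₂} {U} {Z} {R} {Z″} isR apart
                   (_ , Z∉W , Z∉U , ∣Z∣≤k , mod , v , _ , v∉Z , component)
                   (Z″⊆R , Z″∉W₁ , Z″∉U∩R , ∣Z″∣≤ , mod″ , connected″) =
    (λ _ → ∈⊤)
  , Ẑ∉W
  , Ẑ∉U
  , ≤-trans (∣replaceOn∣≤∣Z∣ R Z Z″ ∣Z″∣≤) ∣Z∣≤k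
  , Modulator-replaceOn (ReachableSet-closed isR) mod″ mod
  , exactComponent
  where
  Ẑ = replaceOn R Z Z″

  Ẑ∉W : ∀ x → x ∈ Ẑ → x ∉ W₁ ∪ W₂
  Ẑ∉W x x∈Ẑ x∈W with replaceOn⁻ x∈Ẑ | x∈p∪q⁻ W₁ W₂ x∈W
  ... | inj₁ x∈Z  | _          = Z∉W x x∈Z x∈W
  ... | inj₂ x∈Z″ | inj₁ x∈W₁ = Z″∉W₁ x x∈Z″ x∈W₁
  ... | inj₂ x∈Z″ | inj₂ x∈W₂ = ReachableSet-apart isR apart (Z″⊆R x∈Z″) x∈W₂

  Ẑ∉U : ∀ x → x ∈ Ẑ → x ∉ U
  Ẑ∉U x x∈Ẑ x∈U with replaceOn⁻ x∈Ẑ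
  ... | inj₁ x∈Z  = Z∉U x x∈Z x∈U
  ... | inj₂ x∈Z″ = Z″∉U∩R x x∈Z″ (x∈p∩q⁺ (x∈U , Z″⊆R x∈Z″))

  ExactComponentAt : Fin n → Set
  ExactComponentAt u = ∀ w → w ∈ W₁ ∪ W₂ →
    (w ∈ W₁ → Reach G (⊤ ─ Ẑ) u w) × (Reach G (⊤ ─ Ẑ) u w → w ∈ W₁)

  -- If W₁ = ∅ then R = ∅ and Ẑ = Z, so the component of v still works;
  -- otherwise the component of any w₁ ∈ W₁ lies in R and contains all of W₁.
  exactComponent : Σ (Fin n) λ u → u ∈ ⊤ × u ∉ Ẑ × ExactComponentAt u
  exactComponent with any? (_∈? W₁)
  ... | yes (w₁ , w₁∈W₁) =
    w₁ , ∈⊤ , (λ w₁∈Ẑ → Z″∉W₁ w₁ (replaceOn-inside⁻ w₁∈R w₁∈Ẑ) w₁∈W₁) , λ w w∈W →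
        (λ w∈W₁ → Reach-mono G R─Z″⊆⊤─Ẑ (connected″ w₁ w w₁∈W₁ w∈W₁))
      , (λ r → [ (λ w∈W₁ → w∈W₁)
               , (λ w∈W₂ → ⊥-elim (apart w₁ w w₁∈W₁ w∈W₂ (Reach-mono G (λ _ → ∈⊤) r))) ]′
               (x∈p∪q⁻ W₁ W₂ w∈W))
    where
    w₁∈R : w₁ ∈ R
    w₁∈R = ReachableSet-⊇ isR w₁∈W₁

    R─Z″⊆⊤─Ẑ : R ─ Z″ ⊆ ⊤ ─ Ẑ
    R─Z″⊆⊤─Ẑ x∈ = x∈p∧x∉q⇒x∈p─q ∈⊤ λ x∈Ẑ →
      x∈p─q⇒x∉q x∈ (replaceOn-inside⁻ (p─q⊆p R Z″ x∈) x∈Ẑ)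
  ... | no W₁-empty =
    v , ∈⊤ , (λ v∈Ẑ → v∉Z (replaceOn-outside⁻ Z″⊆R R-empty v∈Ẑ)) , λ w w∈W →
        (λ w∈W₁ → ⊥-elim (W₁-empty (w , w∈W₁)))
      , (λ r → proj₂ (component w w∈W) (Reach-mono G ⊤─Ẑ⊆⊤─Z r))
    where
    R-empty : ∀ {x} → x ∉ R
    R-empty {x} x∈R with proj₁ (isR x) x∈R
    ... | w , w∈W₁ , _ = W₁-empty (w , w∈W₁)

    ⊤─Ẑ⊆⊤─Z : ⊤ ─ Ẑ ⊆ ⊤ ─ Z
    ⊤─Ẑ⊆⊤─Z x∈ = x∈p∧x∉q⇒x∈p─q ∈⊤ λ x∈Z → x∈p─q⇒x∉q x∈ (replaceOn-outside⁺ R-empty x∈Z)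

lemma7 : {n d : ℕ} (G : Graph n) (Fs : Fin d → List FGraph) (k : ℕ)
         (W1 W2 U : Subset n) →
         (∀ v → v ∈ W1 → v ∉ W2) →
         Modulator G Fs ⊤ (W1 ∪ W2) →
         ∣ W1 ∪ W2 ∣ ≡ suc k →
         (∀ w1 w2 → w1 ∈ W1 → w2 ∈ W2 → ¬ Reach G ⊤ w1 w2) →
         (Z : Subset n) → Solution G Fs ⊤ k (W1 ∪ W2) W1 U Z →
         (R : Subset n) →
         (∀ v → (v ∈ R → Σ (Fin n) λ w → w ∈ W1 × Reach G ⊤ w v)
              × ((Σ (Fin n) λ w → w ∈ W1 × Reach G ⊤ w v) → v ∈ R)) →
         (Σ (Subset n) λ Z'' → NonSepSolution G Fs R ∣ Z ∩ R ∣ W1 (U ∩ R) Z'')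
         × (∀ Z'' → NonSepSolution G Fs R ∣ Z ∩ R ∣ W1 (U ∩ R) Z'' →
              Solution G Fs ⊤ k (W1 ∪ W2) W1 U ((Z ─ (Z ∩ R)) ∪ Z''))
lemma7 G Fs k W1 W2 U _ _ _ apart Z sol R isR =
    (Z ∩ R , Solution-restrict (p⊆p∪q W2) (ReachableSet-closed isR) (ReachableSet-⊇ isR) sol)
  , λ Z'' → Solution-replaceOn isR apart sol
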